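{- Let $G$ be a graph, $t$ an integer, and let $A\subseteq V(G)$ be a $t$-enclave in $G$. Then there exists a $t$-island $S\subseteq A$ in $G$.
   Context: For $A\subseteq V(G)$, $e_G(A)$ is the number of edges of $G$ with at least one end in $A$. $A$ is a $t$-enclave if $e_G(A)<t|A|$. A $t$-island in $G$ is a non-empty $S\subseteq V(G)$ such that every vertex of $S$ has fewer than $t$ neighbors in $V(G)\setminus S$. -}

module Defs where

open import Data.Nat using (ℕ; zero; suc; _+_; _<ᵇ_)
open import Data.Bool using (Bool; true; false; _∧_; _∨_; not; if_then_else_)
open import Data.Fin using (Fin; toℕ)
open import Data.Fin.Subset using (Subset; _∈_; _∉_; _⊆_; Nonempty; ∣_∣)
open import Data.Vec using (lookup)
open import Data.Integer using (ℤ; +_; _*_; _<_)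
open import Relation.Binary.PropositionalEquality using (_≡_)
open import Data.Product using (_×_)

record Graph (n : ℕ) : Set where
  field
    adj    : Fin n → Fin n → Bool
    sym    : ∀ u v → adj u v ≡ adj v u
    irrefl : ∀ v → adj v v ≡ false
open Graph public

count : ∀ {n} → (Fin n → Bool) → ℕ
count {zero}  p = 0
count {suc n} p = (if p Fin.zero then 1 else 0) + count (λ i → p (Fin.suc i))

sumF : ∀ {n} → (Fin n → ℕ) → ℕ
sumF {zero}  f = 0
sumF {suc n} f = f Fin.zero + sumF (λ i → f (Fin.suc i))

mem : ∀ {n} → Fin n → Subset n → Bool
mem v A = lookup A v

eG : ∀ {n} → Graph n → Subset n → ℕ
eG G A = sumF (λ u → count (λ v →
  (toℕ u <ᵇ toℕ v) ∧ adj G u v ∧ (mem u A ∨ mem v A)))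

IsEnclave : ∀ {n} → Graph n → ℤ → Subset n → Set
IsEnclave G t A = + eG G A < t * + ∣ A ∣

outDeg : ∀ {n} → Graph n → Subset n → Fin n → ℕ
outDeg G S v = count (λ w → adj G v w ∧ not (mem w S))

IsIsland : ∀ {n} → Graph n → ℤ → Subset n → Set
IsIsland G t S = Nonempty S × (∀ v → v ∈ S → + outDeg G S v < t)

-- Deleting from an enclave A a vertex v with at least t neighbours outside A removes at
-- least t edges from e_G while lowering the bound t|A| by exactly t, so A - v is again an
-- enclave.  Enclaves are nonempty, so deleting such vertices until none is left (which
-- must happen, as A shrinks) ends in a t-island.  A negative t admits no enclave at all.

module Submission where

open import Defs hiding (sym)
open import Data.Bool using (Bool; true; false; _∧_; _∨_; not; if_then_else_; T)
open import Data.Fin using (Fin; zero; suc; toℕ)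
open import Data.Fin.Properties using (_≟_; toℕ-injective; any?)
open import Data.Fin.Subset using (Subset; _⊆_; _⊂_; _∈_; _-_; ⁅_⁆; ⊥; ∣_∣; Nonempty; inside; outside)
open import Data.Fin.Subset.Properties
  using (_∈?_; nonempty?; Empty-unique; ∣⊥∣≡0; p─⊥≡p; p─q⊆p; x∈p⇒p-x⊂p)
open import Data.Fin.Subset.Induction using (Acc; acc; ⊂-wellFounded)
open import Data.Integer as ℤ using (ℤ; -[1+_])
import Data.Integer.Properties as ℤ
open import Data.Nat using (ℕ; zero; suc; _+_; _*_; _≤_; _<_; _<ᵇ_; _≤?_; z≤n)
open import Data.Nat.Properties hiding (_≟_)
open import Data.Product using (Σ; _×_; _,_)
open import Data.Vec using (_∷_; here; there)
open import Data.Vec.Properties using ([]=⇒lookup)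
open import Function using (_∘_; id)
open import Relation.Binary.PropositionalEquality
open import Relation.Nullary using (yes; no; does; ¬_; contradiction)
open import Relation.Nullary.Decidable using (_×-dec_)
open import Algebra.Properties.Semiring.Sum +-*-semiring
  using (sum-syntax; ∑-distrib-+; *-distribˡ-sum; sum-cong-≗; sum-replicate-zero)

⟦_⟧ : Bool → ℕ
⟦ b ⟧ = if b then 1 else 0

sumF≡∑ : ∀ {n} (f : Fin n → ℕ) → sumF f ≡ ∑[ i < n ] f i
sumF≡∑ {zero}  f = refl
sumF≡∑ {suc n} f = cong (f zero +_) (sumF≡∑ (f ∘ suc))

count≡∑ : ∀ {n} (p : Fin n → Bool) → count p ≡ ∑[ i < n ] ⟦ p i ⟧
count≡∑ {zero}  p = refl
count≡∑ {suc n} p = cong (⟦ p zero ⟧ +_) (count≡∑ (p ∘ suc))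

∑-mono-≤ : ∀ {n} {f g : Fin n → ℕ} → (∀ i → f i ≤ g i) → ∑[ i < n ] f i ≤ ∑[ i < n ] g i
∑-mono-≤ {zero}  f≤g = z≤n
∑-mono-≤ {suc n} f≤g = +-mono-≤ (f≤g zero) (∑-mono-≤ (f≤g ∘ suc))

∑-select : ∀ {n} (j : Fin n) (f : Fin n → ℕ) → ∑[ i < n ] (⟦ does (i ≟ j) ⟧ * f i) ≡ f j
∑-select {suc n} zero    f =
  trans (cong₂ _+_ (+-identityʳ (f zero)) (sum-replicate-zero n)) (+-identityʳ (f zero))
∑-select {suc n} (suc j) f = ∑-select j (f ∘ suc)

<ᵇ-irrefl : ∀ m → (m <ᵇ m) ≡ false
<ᵇ-irrefl zero    = refl
<ᵇ-irrefl (suc m) = <ᵇ-irrefl m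

<ᵇ≡false⇒≮ : ∀ m n → (m <ᵇ n) ≡ false → ¬ m < n
<ᵇ≡false⇒≮ m n m≮n m<n = subst T m≮n (<⇒<ᵇ m<n)

mem-p-x : ∀ {n} (p : Subset n) (x : Fin n) → mem x (p - x) ≡ false
mem-p-x (_ ∷ p) zero    = refl
mem-p-x (_ ∷ p) (suc x) = mem-p-x p x

mem-p-y : ∀ {n} (p : Subset n) {x y : Fin n} → x ≢ y → mem x (p - y) ≡ mem x p
mem-p-y (_ ∷ p) {zero}  {zero}  x≢y = contradiction refl x≢y
mem-p-y (_ ∷ p) {zero}  {suc y} x≢y = refl
mem-p-y (_ ∷ p) {suc x} {zero}  x≢y = cong (mem x) (p─⊥≡p p)
mem-p-y (_ ∷ p) {suc x} {suc y} x≢y = mem-p-y p (x≢y ∘ cong suc)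

∣p-x∣+1≡∣p∣ : ∀ {n} {p : Subset n} {x : Fin n} → x ∈ p → suc ∣ p - x ∣ ≡ ∣ p ∣
∣p-x∣+1≡∣p∣ {p = inside ∷ p} here = cong (suc ∘ ∣_∣) (p─⊥≡p p)
∣p-x∣+1≡∣p∣ {p = inside  ∷ p} (there x∈p) = cong suc (∣p-x∣+1≡∣p∣ x∈p)
∣p-x∣+1≡∣p∣ {p = outside ∷ p} (there x∈p) = ∣p-x∣+1≡∣p∣ x∈p

m<k*∣p∣⇒Nonempty : ∀ {n m k} {p : Subset n} → m < k * ∣ p ∣ → Nonempty p
m<k*∣p∣⇒Nonempty {n} {k = k} {p} m<k∣p∣ with nonempty? p
... | yes nonempty = nonempty
... | no  empty    = contradiction k∣p∣≡0 (m<n⇒n≢0 m<k∣p∣)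
  where
  k∣p∣≡0 : k * ∣ p ∣ ≡ 0
  k∣p∣≡0 = begin
    k * ∣ p ∣         ≡⟨ cong (λ q → k * ∣ q ∣) (Empty-unique empty) ⟩
    k * ∣ ⊥ {n = n} ∣ ≡⟨ cong (k *_) (∣⊥∣≡0 n) ⟩
    k * 0             ≡⟨ *-zeroʳ k ⟩
    0                 ∎
    where open ≡-Reasoning

module _ {n} (G : Graph n) where

  meets : Subset n → Fin n → Fin n → Bool
  meets X u w = (toℕ u <ᵇ toℕ w) ∧ adj G u w ∧ (mem u X ∨ mem w X)

  eG≡∑∑meets : ∀ X → eG G X ≡ ∑[ u < n ] ∑[ w < n ] ⟦ meets X u w ⟧
  eG≡∑∑meets X = trans (sumF≡∑ (λ u → count (meets X u))) (sum-cong-≗ (λ u → count≡∑ (meets X u)))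

  -- Edges from v to V ∖ A, split by orientation since eG counts each edge once, as u < w.
  cutAbove cutBelow : Subset n → Fin n → Fin n → ℕ
  cutAbove A v w = ⟦ (toℕ v <ᵇ toℕ w) ∧ adj G v w ∧ not (mem w A) ⟧
  cutBelow A v u = ⟦ (toℕ u <ᵇ toℕ v) ∧ adj G u v ∧ not (mem u A) ⟧

  outEdge≤cut : ∀ A v w → ⟦ adj G v w ∧ not (mem w A) ⟧ ≤ cutAbove A v w + cutBelow A v w
  outEdge≤cut A v w with toℕ v <ᵇ toℕ w in v<w | toℕ w <ᵇ toℕ v in w<v
  ... | true  | _     = m≤m+n _ _
  ... | false | true  rewrite Graph.sym G w v = m≤n+m _ _
  ... | false | false with toℕ-injective (≤-antisym (≮⇒≥ (<ᵇ≡false⇒≮ (toℕ w) (toℕ v) w<v))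
                                                    (≮⇒≥ (<ᵇ≡false⇒≮ (toℕ v) (toℕ w) v<w)))
  ... | refl rewrite irrefl G v = z≤n

  outDeg≤∑cut : ∀ A v → outDeg G A v ≤ ∑[ w < n ] cutAbove A v w + ∑[ u < n ] cutBelow A v u
  outDeg≤∑cut A v = begin
    outDeg G A v                                          ≡⟨ count≡∑ (λ w → adj G v w ∧ not (mem w A)) ⟩
    ∑[ w < n ] ⟦ adj G v w ∧ not (mem w A) ⟧               ≤⟨ ∑-mono-≤ (outEdge≤cut A v) ⟩
    ∑[ w < n ] (cutAbove A v w + cutBelow A v w)          ≡⟨ ∑-distrib-+ (cutAbove A v) (cutBelow A v) ⟩
    ∑[ w < n ] cutAbove A v w + ∑[ u < n ] cutBelow A v u ∎
    where open ≤-Reasoning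

  -- The edges between v and V ∖ A, indexed by the ordered pairs (u , w) over which eG sums:
  -- exactly the pairs counted in eG G A but not in eG G (A - v).
  lost : Subset n → Fin n → Fin n → Fin n → ℕ
  lost A v u w = ⟦ does (u ≟ v) ⟧ * cutAbove A v w + ⟦ does (w ≟ v) ⟧ * cutBelow A v u

  ∑∑lost : ∀ A v → ∑[ u < n ] ∑[ w < n ] lost A v u w
                 ≡ ∑[ w < n ] cutAbove A v w + ∑[ u < n ] cutBelow A v u
  ∑∑lost A v = begin
    ∑[ u < n ] ∑[ w < n ] lost A v u w
      ≡⟨ sum-cong-≗ (λ u → ∑-distrib-+ (λ w → δ u * cutAbove A v w) (λ w → δ w * cutBelow A v u)) ⟩
    ∑[ u < n ] (∑[ w < n ] (δ u * cutAbove A v w) + ∑[ w < n ] (δ w * cutBelow A v u))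
      ≡⟨ sum-cong-≗ (λ u → cong₂ _+_ (sym (*-distribˡ-sum (δ u) (cutAbove A v)))
                                     (∑-select v (λ _ → cutBelow A v u))) ⟩
    ∑[ u < n ] (δ u * ∑[ w < n ] cutAbove A v w + cutBelow A v u)
      ≡⟨ ∑-distrib-+ (λ u → δ u * ∑[ w < n ] cutAbove A v w) (cutBelow A v) ⟩
    ∑[ u < n ] (δ u * ∑[ w < n ] cutAbove A v w) + ∑[ u < n ] cutBelow A v u
      ≡⟨ cong (_+ ∑[ u < n ] cutBelow A v u) (∑-select v (λ _ → ∑[ w < n ] cutAbove A v w)) ⟩
    ∑[ w < n ] cutAbove A v w + ∑[ u < n ] cutBelow A v u ∎
    where
    open ≡-Reasoning
    δ : Fin n → ℕ
    δ u = ⟦ does (u ≟ v) ⟧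

  meets-remove : ∀ {A v} → v ∈ A → ∀ u w → ⟦ meets (A - v) u w ⟧ + lost A v u w ≤ ⟦ meets A u w ⟧
  meets-remove {A} {v} v∈A u w with u ≟ v | w ≟ v
  ... | yes refl | yes refl rewrite <ᵇ-irrefl (toℕ u) = z≤n
  ... | yes refl | no w≢u rewrite mem-p-x A u | mem-p-y A w≢u | []=⇒lookup v∈A
    with toℕ u <ᵇ toℕ w | adj G u w | mem w A
  ...   | false | _     | _     = z≤n
  ...   | true  | false | _     = z≤n
  ...   | true  | true  | true  = ≤-refl
  ...   | true  | true  | false = ≤-refl
  meets-remove {A} v∈A u w | no u≢w | yes refl rewrite mem-p-x A w | mem-p-y A u≢w | []=⇒lookup v∈A
    with toℕ u <ᵇ toℕ w | adj G u w | mem u A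
  ...   | false | _     | _     = z≤n
  ...   | true  | false | _     = z≤n
  ...   | true  | true  | true  = ≤-refl
  ...   | true  | true  | false = ≤-refl
  meets-remove {A} v∈A u w | no u≢v | no w≢v rewrite mem-p-y A u≢v | mem-p-y A w≢v =
    ≤-reflexive (+-identityʳ _)

  eG-remove : ∀ {A v} → v ∈ A → eG G (A - v) + outDeg G A v ≤ eG G A
  eG-remove {A} {v} v∈A = begin
    eG G (A - v) + outDeg G A v
      ≤⟨ +-monoʳ-≤ (eG G (A - v)) (outDeg≤∑cut A v) ⟩
    eG G (A - v) + (∑[ w < n ] cutAbove A v w + ∑[ u < n ] cutBelow A v u)
      ≡⟨ cong₂ _+_ (eG≡∑∑meets (A - v)) (sym (∑∑lost A v)) ⟩
    ∑[ u < n ] ∑[ w < n ] ⟦ meets (A - v) u w ⟧ + ∑[ u < n ] ∑[ w < n ] lost A v u w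
      ≡⟨ sym (∑-distrib-+ (λ u → ∑[ w < n ] ⟦ meets (A - v) u w ⟧) (λ u → ∑[ w < n ] lost A v u w)) ⟩
    ∑[ u < n ] (∑[ w < n ] ⟦ meets (A - v) u w ⟧ + ∑[ w < n ] lost A v u w)
      ≡⟨ sum-cong-≗ (λ u → sym (∑-distrib-+ (λ w → ⟦ meets (A - v) u w ⟧) (lost A v u))) ⟩
    ∑[ u < n ] ∑[ w < n ] (⟦ meets (A - v) u w ⟧ + lost A v u w)
      ≤⟨ ∑-mono-≤ (λ u → ∑-mono-≤ (meets-remove v∈A u)) ⟩
    ∑[ u < n ] ∑[ w < n ] ⟦ meets A u w ⟧
      ≡⟨ eG≡∑∑meets A ⟨
    eG G A ∎
    where open ≤-Reasoning

  enclave-remove : ∀ {t A v} → v ∈ A → t ≤ outDeg G A v →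
                   eG G A < t * ∣ A ∣ → eG G (A - v) < t * ∣ A - v ∣
  enclave-remove {t} {A} {v} v∈A t≤deg enclave = +-cancelˡ-< t _ _ (begin-strict
    t + eG G (A - v)            ≡⟨ +-comm t _ ⟩
    eG G (A - v) + t            ≤⟨ +-monoʳ-≤ (eG G (A - v)) t≤deg ⟩
    eG G (A - v) + outDeg G A v ≤⟨ eG-remove v∈A ⟩
    eG G A                      <⟨ enclave ⟩
    t * ∣ A ∣                   ≡⟨ cong (t *_) (∣p-x∣+1≡∣p∣ v∈A) ⟨
    t * suc ∣ A - v ∣           ≡⟨ *-suc t ∣ A - v ∣ ⟩
    t + t * ∣ A - v ∣           ∎)
    where open ≤-Reasoning

  enclave⇒island : ∀ t A → Acc _⊂_ A → eG G A < t * ∣ A ∣ →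
                   Σ (Subset n) (λ S → S ⊆ A × IsIsland G (ℤ.+ t) S)
  enclave⇒island t A (acc smaller) enclave with any? (λ v → v ∈? A ×-dec t ≤? outDeg G A v)
  ... | yes (v , v∈A , t≤deg) =
    let S , S⊆A-v , island = enclave⇒island t (A - v) (smaller (x∈p⇒p-x⊂p v∈A))
                                             (enclave-remove v∈A t≤deg enclave)
    in S , p─q⊆p A ⁅ v ⁆ ∘ S⊆A-v , island
  ... | no noHeavy = A , id , m<k*∣p∣⇒Nonempty {k = t} enclave ,
                     λ v v∈A → ℤ.+<+ (≰⇒> λ t≤deg → noHeavy (v , v∈A , t≤deg))

lemma21 : ∀ {n} (G : Graph n) (t : ℤ) (A : Subset n) →
    IsEnclave G t A → Σ (Subset n) (λ S → S ⊆ A × IsIsland G t S)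
lemma21 G (ℤ.+ t) A enclave = enclave⇒island G t A (⊂-wellFounded A)
  (ℤ.drop‿+<+ (subst (ℤ.+ eG G A ℤ.<_) (sym (ℤ.pos-* t ∣ A ∣)) enclave))
lemma21 G -[1+ t ] A enclave = contradiction
  (ℤ.<-≤-trans enclave (ℤ.≤-trans (ℤ.*-monoˡ-≤-nonPos -[1+ t ] (ℤ.+≤+ z≤n))
                                 (ℤ.≤-reflexive (ℤ.*-zeroʳ -[1+ t ]))))
  ℤ.+≮0
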